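{- Let $G=(V,E)$ be a graph, let $\langle c,x\rangle\geqslant\lambda$ be a facet-defining inequality for $\mathrm{CUT}(G)$ with $\lambda>0$ and $c(e)\neq 0$ for every $e\in E$, and let $\mathcal F$ be a family of subsets of $V$ such that $\{\delta(S): S\in\mathcal F\}$ is a basis of minimum cuts. For every $E'\subseteq E$ such that $G/E'$ has at least two nodes, the inequality $\langle c/E',x\rangle\geqslant\lambda$ is valid for $\mathrm{CUT}(G/E')$, and the face of $\mathrm{CUT}(G/E')$ that it defines has dimension at least $|\{S\in\mathcal F : \delta(S)\cap E'=\varnothing\}|-1$.
   Context: Graphs are finite, undirected, may have loops and parallel edges, and have at least two nodes. For $S\subseteq V$, $\delta(S)$ is the set of edges with exactly one endnode in $S$; $\chi^F$ is the characteristic vector of $F\subseteq E$ and $c(F)=\sum_{e\in F}c(e)$. The cut dominant is $\mathrm{CUT}(G)=\mathrm{conv}\{\chi^{\delta(S)} : \varnothing\neq S\subsetneq V\}+\mathbb{R}^E_+$. For $c\ge 0$, $\lambda^c(G)=\min\{c(\delta(S)):\varnothing\neq S\subsetneq V\}$, and a cut $\delta(S)$ with $\varnothing\neq S\subsetneq V$ attaining it is a minimum cut. "$\{\delta(S):S\in\mathcal F\}$ is a basis of minimum cuts" means $\mathcal F$ consists of $|E|$ sets $S$ with $\varnothing\neq S\subsetneq V$, each $\delta(S)$ a minimum cut with respect to $c$, with the vectors $\chi^{\delta(S)}$ linearly independent. $G/E'$ is the graph obtained by contracting all edges in $E'$ (its edge set is identified with $E\smallsetminus E'$), and $c/E'$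 is the restriction of $c$ to $E\smallsetminus E'$.
   Formalization: The coefficients c(e) and λ are rational rather than real, and CUT(G), CUT(G/E') and their faces consist of points with rational coordinates. -}

module Defs where

open import Data.Nat as ℕ using (ℕ; zero; suc)
open import Data.Bool using (Bool; true; false; not; _∧_; _xor_; if_then_else_)
open import Data.Fin using (Fin; zero; suc)
open import Data.Fin.Subset using (Subset; _∈_; _∉_; Nonempty; ∁; _∩_; ∣_∣)
open import Data.Vec using (Vec; []; _∷_; lookup; tabulate)
open import Data.Product using (Σ; ∃; ∃-syntax; _×_; _,_; proj₁; proj₂)
open import Data.Rational using (ℚ; 0ℚ; 1ℚ; _+_; _*_; _≤_; _<_)
open import Relation.Binary.PropositionalEquality using (_≡_)
open import Relation.Nullary using (¬_)
open import Function.Bundles using (_⇔_)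
open import Function.Definitions using (Injective)

∑ : ∀ {k} → (Fin k → ℚ) → ℚ
∑ {zero}  f = 0ℚ
∑ {suc k} f = f zero + ∑ (λ i → f (suc i))

⟨_,_⟩ : ∀ {m} → (Fin m → ℚ) → (Fin m → ℚ) → ℚ
⟨ c , x ⟩ = ∑ (λ e → c e * x e)

-- Graphs: nodes Fin n, edges Fin m, each edge has a pair of endnodes
-- (loops and parallel edges allowed).

record Graph : Set where
  field
    n    : ℕ
    m    : ℕ
    ends : Fin m → Fin n × Fin n
open Graph public

inCut : (G : Graph) → Subset (n G) → Fin (m G) → Bool
inCut G S e = lookup S (proj₁ (ends G e)) xor lookup S (proj₂ (ends G e))

δ : (G : Graph) → Subset (n G) → Subset (m G)
δ G S = tabulate (inCut G S)

χδ : (G : Graph) → Subset (n G) → Fin (m G) → ℚ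
χδ G S e = if inCut G S e then 1ℚ else 0ℚ

cutWeight : (G : Graph) → (Fin (m G) → ℚ) → Subset (n G) → ℚ
cutWeight G c S = ⟨ c , χδ G S ⟩

Proper : ∀ {n} → Subset n → Set
Proper S = Nonempty S × Nonempty (∁ S)

IsMinCut : (G : Graph) → (Fin (m G) → ℚ) → Subset (n G) → Set
IsMinCut G c S = Proper S × (∀ T → Proper T → cutWeight G c S ≤ cutWeight G c T)

-- The cut dominant CUT(G) = conv{χ^δ(S)} + ℝ^E_+ (as a set of points)

CUT : (G : Graph) → (Fin (m G) → ℚ) → Set
CUT G x =
  ∃[ k ] Σ (Fin k → Subset (n G)) λ S → Σ (Fin k → ℚ) λ μ →
    (∀ i → Proper (S i)) × (∀ i → 0ℚ ≤ μ i) × (∑ μ ≡ 1ℚ) ×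
    (∀ e → ∑ (λ i → μ i * χδ G (S i) e) ≤ x e)

Valid : ∀ {m} → ((Fin m → ℚ) → Set) → (Fin m → ℚ) → ℚ → Set
Valid P c λ₀ = ∀ x → P x → λ₀ ≤ ⟨ c , x ⟩

Face : ∀ {m} → ((Fin m → ℚ) → Set) → (Fin m → ℚ) → ℚ → (Fin m → ℚ) → Set
Face P c λ₀ x = P x × (⟨ c , x ⟩ ≡ λ₀)

AffinelyIndependent : ∀ {m k} → (Fin k → Fin m → ℚ) → Set
AffinelyIndependent {m} {k} p =
  ∀ (a : Fin k → ℚ) → ∑ a ≡ 0ℚ →
    (∀ e → ∑ (λ i → a i * p i e) ≡ 0ℚ) → ∀ i → a i ≡ 0ℚ

LinearlyIndependent : ∀ {m k} → (Fin k → Fin m → ℚ) → Set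
LinearlyIndependent {m} {k} p =
  ∀ (a : Fin k → ℚ) → (∀ e → ∑ (λ i → a i * p i e) ≡ 0ℚ) → ∀ i → a i ≡ 0ℚ

-- P contains k affinely independent points, i.e. dim P ≥ k - 1
HasAffIndep : ∀ {m} → ((Fin m → ℚ) → Set) → ℕ → Set
HasAffIndep {m} P k =
  Σ (Fin k → Fin m → ℚ) λ p → AffinelyIndependent p × (∀ i → P (p i))

HasDim : ∀ {m} → ((Fin m → ℚ) → Set) → ℕ → Set
HasDim P d = HasAffIndep P (suc d) × ¬ HasAffIndep P (suc (suc d))

FacetDefining : ∀ {m} → ((Fin m → ℚ) → Set) → (Fin m → ℚ) → ℚ → Set
FacetDefining P c λ₀ =
  Valid P c λ₀ × ∃[ d ] (HasDim P (suc d) × HasDim (Face P c λ₀) d)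

-- {δ(S) : S ∈ 𝓕} is a basis of minimum cuts (𝓕 indexed by Fin |E|)

BasisOfMinCuts : (G : Graph) → (Fin (m G) → ℚ) → (Fin (m G) → Subset (n G)) → Set
BasisOfMinCuts G c 𝓕 =
  (∀ i → IsMinCut G c (𝓕 i)) × LinearlyIndependent (λ i → χδ G (𝓕 i))

data Conn (G : Graph) (E' : Subset (m G)) : Fin (n G) → Fin (n G) → Set where
  here  : ∀ {u} → Conn G E' u u
  stepˡ : ∀ {u w v} (e : Fin (m G)) → e ∈ E' → ends G e ≡ (u , w) → Conn G E' w v → Conn G E' u v
  stepʳ : ∀ {u w v} (e : Fin (m G)) → e ∈ E' → ends G e ≡ (w , u) → Conn G E' w v → Conn G E' u v

-- H is G/E' : its nodes are the classes of the components of (V,E') via π,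
-- and its edges are E ∖ E' via ι, with endnodes mapped by π.
record IsContraction (G : Graph) (E' : Subset (m G)) (H : Graph)
                     (π : Fin (n G) → Fin (n H)) (ι : Fin (m H) → Fin (m G)) : Set where
  field
    π-surj  : ∀ w → ∃[ v ] (π v ≡ w)
    π-conn  : ∀ u v → (π u ≡ π v) ⇔ Conn G E' u v
    ι-inj   : Injective _≡_ _≡_ ι
    ι-out   : ∀ e → ι e ∉ E'
    ι-onto  : ∀ f → f ∉ E' → ∃[ e ] (ι e ≡ f)
    ι-ends  : ∀ e → ends H e ≡ (π (proj₁ (ends G (ι e))) , π (proj₂ (ends G (ι e))))

noneB : ∀ {k} → Subset k → Bool
noneB []       = true
noneB (x ∷ xs) = not x ∧ noneB xs

countAvoiding : (G : Graph) → Subset (m G) → (Fin (m G) → Subset (n G)) → ℕ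
countAvoiding G E' 𝓕 = ∣ tabulate (λ i → noneB (δ G (𝓕 i) ∩ E')) ∣

-- Let ⟨c,x⟩ ≥ λ₀ be valid for CUT(G) and tight at some point of CUT(G) (for instance a
-- facet-defining inequality).  Since CUT(G) is closed upward, tightness forces c ≥ 0,
-- and then every minimum cut of G has weight exactly λ₀.  For a contraction H = G/E'
-- with node map π and edge embedding ι, the cuts of G that avoid E' are exactly the
-- preimages π⁻¹(T) of node sets T of H, and δ_H(T) is δ_G(π⁻¹ T) restricted along ι.
-- Consequently:
--   * every cut of H weighs as much as a cut of G, hence at least λ₀, and since
--     c ≥ 0 this bound extends by convexity from cuts to all of CUT(H) (validity);
--   * each S ∈ 𝓕 avoiding E' yields a cut of H on the face.  The restriction along ι
--     of a linearly independent family of vectors vanishing on E' is still linearly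
--     independent, so these points are (linearly, hence affinely) independent.
module Submission where

open import Defs
open import Algebra.Bundles using (CommutativeRing)
open import Data.Bool using (true; false; not; _∧_; _xor_; if_then_else_)
open import Data.Bool.Properties using (xor-same; ∧-identityʳ)
open import Data.Empty using (⊥-elim)
open import Data.Fin using (Fin; zero; suc; _≟_)
open import Data.Fin.Properties using (any?; suc-injective)
open import Data.Fin.Subset using (Subset; inside; outside; _∈_; ∁; _∩_; Nonempty; ∣_∣)
open import Data.Fin.Subset.Properties using (_∈?_)
open import Data.Nat as ℕ using (zero; suc)
open import Data.Product using (Σ; ∃; ∃-syntax; _×_; _,_; proj₁; proj₂)
open import Data.Rational using (ℚ; 0ℚ; 1ℚ; _+_; _*_; _≤_; _<_; nonNegative)
open import Data.Rational.Properties
  using ( ≤-refl; ≤-trans; ≤-reflexive; ≤-antisym; <⇒≤; ≮⇒≥; <-irrefl; positive⁻¹; module ≤-Reasoning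
        ; +-mono-≤; +-monoʳ-≤; +-monoʳ-<; +-identityˡ; +-identityʳ
        ; *-zeroˡ; *-zeroʳ; *-identityˡ; *-identityʳ; *-comm; *-assoc; *-distribˡ-+; *-monoˡ-≤-nonNeg
        ; +-*-commutativeRing )
open import Data.Sum using (_⊎_; inj₁; inj₂)
open import Data.Vec using (_∷_; lookup; tabulate; here; there)
open import Data.Vec.Properties using ([]=⇒lookup; lookup⇒[]=; lookup∘tabulate; lookup-map; lookup-zipWith)
open import Function.Base using (_∘_)
open import Function.Bundles using (Equivalence; mk⇔)
open import Function.Definitions using (Injective)
open import Relation.Binary.PropositionalEquality
  using (_≡_; refl; sym; trans; cong; cong₂; subst; module ≡-Reasoning)
open import Relation.Nullary using (¬_; does; yes; no)
open import Relation.Nullary.Decidable using (does-⇔)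

open import Algebra.Properties.Semiring.Sum (CommutativeRing.semiring +-*-commutativeRing)
  using (sum; ∑-distrib-+; ∑-comm; *-distribˡ-sum; sum-replicate-zero)

-- The sum ∑ of Defs is the library's sum over the semiring ℚ, so its algebraic laws
-- can be imported from there.
∑≡sum : ∀ {k} (f : Fin k → ℚ) → ∑ f ≡ sum f
∑≡sum {zero}  f = refl
∑≡sum {suc k} f = cong (f zero +_) (∑≡sum (λ i → f (suc i)))

∑-cong : ∀ {k} {f g : Fin k → ℚ} → (∀ i → f i ≡ g i) → ∑ f ≡ ∑ g
∑-cong {zero}  eq = refl
∑-cong {suc k} eq = cong₂ _+_ (eq zero) (∑-cong (λ i → eq (suc i)))

∑-mono : ∀ {k} {f g : Fin k → ℚ} → (∀ i → f i ≤ g i) → ∑ f ≤ ∑ g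
∑-mono {zero}  le = ≤-refl
∑-mono {suc k} le = +-mono-≤ (le zero) (∑-mono (λ i → le (suc i)))

∑-zero : ∀ {k} {f : Fin k → ℚ} → (∀ i → f i ≡ 0ℚ) → ∑ f ≡ 0ℚ
∑-zero {k} eq = trans (∑-cong eq) (trans (∑≡sum {k} (λ _ → 0ℚ)) (sum-replicate-zero k))

∑-+ : ∀ {k} (f g : Fin k → ℚ) → ∑ (λ i → f i + g i) ≡ ∑ f + ∑ g
∑-+ f g = begin
  ∑ (λ i → f i + g i)  ≡⟨ ∑≡sum (λ i → f i + g i) ⟩
  sum (λ i → f i + g i) ≡⟨ ∑-distrib-+ f g ⟩
  sum f + sum g         ≡⟨ sym (cong₂ _+_ (∑≡sum f) (∑≡sum g)) ⟩
  ∑ f + ∑ g             ∎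
  where open ≡-Reasoning

∑-*ˡ : ∀ {k} (a : ℚ) (f : Fin k → ℚ) → ∑ (λ i → a * f i) ≡ a * ∑ f
∑-*ˡ a f = begin
  ∑ (λ i → a * f i)   ≡⟨ ∑≡sum (λ i → a * f i) ⟩
  sum (λ i → a * f i) ≡⟨ sym (*-distribˡ-sum a f) ⟩
  a * sum f           ≡⟨ cong (a *_) (sym (∑≡sum f)) ⟩
  a * ∑ f             ∎
  where open ≡-Reasoning

∑-swap : ∀ {k l} (f : Fin k → Fin l → ℚ) →
  ∑ (λ i → ∑ (λ j → f i j)) ≡ ∑ (λ j → ∑ (λ i → f i j))
∑-swap f = begin
  ∑ (λ i → ∑ (λ j → f i j))     ≡⟨ ∑-cong (λ i → ∑≡sum (f i)) ⟩
  ∑ (λ i → sum (λ j → f i j))   ≡⟨ ∑≡sum (λ i → sum (λ j → f i j)) ⟩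
  sum (λ i → sum (λ j → f i j)) ≡⟨ ∑-comm f ⟩
  sum (λ j → sum (λ i → f i j)) ≡⟨ sym (∑≡sum (λ j → sum (λ i → f i j))) ⟩
  ∑ (λ j → sum (λ i → f i j))   ≡⟨ sym (∑-cong (λ j → ∑≡sum (λ i → f i j))) ⟩
  ∑ (λ j → ∑ (λ i → f i j))     ∎
  where open ≡-Reasoning

onlyAt : ∀ {k} → Fin k → Fin k → ℚ → ℚ
onlyAt i j x = if does (i ≟ j) then x else 0ℚ

onlyAt-zero : ∀ {k} (i j : Fin k) → onlyAt i j 0ℚ ≡ 0ℚ
onlyAt-zero i j with does (i ≟ j)
... | true  = refl
... | false = refl

*-onlyAt : ∀ {k} (i j : Fin k) (x y : ℚ) → x * onlyAt i j y ≡ onlyAt i j (x * y)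
*-onlyAt i j x y with does (i ≟ j)
... | true  = refl
... | false = *-zeroʳ x

onlyAt-injective : ∀ {k l} (s : Fin k → Fin l) → Injective _≡_ _≡_ s →
  ∀ i i₀ (x : ℚ) → onlyAt (s i) (s i₀) x ≡ onlyAt i₀ i x
onlyAt-injective s s-inj i i₀ x =
  cong (if_then x else 0ℚ) (does-⇔ (mk⇔ (sym ∘ s-inj) (cong s ∘ sym)) (s i ≟ s i₀) (i₀ ≟ i))

∑-onlyAt : ∀ {k} (i : Fin k) (h : Fin k → ℚ) → ∑ (λ j → onlyAt i j (h j)) ≡ h i
∑-onlyAt {suc k} zero    h = trans (cong (h zero +_) (∑-zero {k} (λ _ → refl))) (+-identityʳ (h zero))
∑-onlyAt {suc k} (suc i) h = trans (+-identityˡ _) (∑-onlyAt i (λ j → h (suc j)))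

∑-reindex : ∀ {k l} (s : Fin k → Fin l) → Injective _≡_ _≡_ s → (g : Fin l → ℚ) →
  (∀ j → (∃ λ i → s i ≡ j) ⊎ g j ≡ 0ℚ) → ∑ (λ i → g (s i)) ≡ ∑ g
∑-reindex s s-inj g covers = begin
  ∑ (λ i → g (s i))                        ≡⟨ ∑-cong (λ i → sym (∑-onlyAt (s i) g)) ⟩
  ∑ (λ i → ∑ (λ j → onlyAt (s i) j (g j))) ≡⟨ ∑-swap (λ i j → onlyAt (s i) j (g j)) ⟩
  ∑ (λ j → ∑ (λ i → onlyAt (s i) j (g j))) ≡⟨ ∑-cong column ⟩
  ∑ g                                      ∎
  where
  open ≡-Reasoning
  column : ∀ j → ∑ (λ i → onlyAt (s i) j (g j)) ≡ g j
  column j with covers j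
  ... | inj₁ (i₀ , refl) =
    trans (∑-cong (λ i → onlyAt-injective s s-inj i i₀ (g (s i₀)))) (∑-onlyAt i₀ (λ _ → g (s i₀)))
  ... | inj₂ gj≡0 =
    trans (∑-zero (λ i → trans (cong (onlyAt (s i) j) gj≡0) (onlyAt-zero (s i) j))) (sym gj≡0)

extend : ∀ {k l} → (Fin k → Fin l) → (Fin k → ℚ) → Fin l → ℚ
extend s a j with any? (λ i → s i ≟ j)
... | yes (i , _) = a i
... | no  _       = 0ℚ

extend-image : ∀ {k l} (s : Fin k → Fin l) → Injective _≡_ _≡_ s →
  (a : Fin k → ℚ) → ∀ i → extend s a (s i) ≡ a i
extend-image s s-inj a i with any? (λ i′ → s i′ ≟ s i)
... | yes (i′ , si′≡si) = cong a (s-inj si′≡si)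
... | no  ∄i′           = ⊥-elim (∄i′ (i , refl))

extend-support : ∀ {k l} (s : Fin k → Fin l) (a : Fin k → ℚ) →
  ∀ j → (∃ λ i → s i ≡ j) ⊎ extend s a j ≡ 0ℚ
extend-support s a j with any? (λ i → s i ≟ j)
... | yes image = inj₁ image
... | no  _     = inj₂ refl

linIndep-sub : ∀ {k l d} (p : Fin l → Fin d → ℚ) (s : Fin k → Fin l) → Injective _≡_ _≡_ s →
  LinearlyIndependent p → LinearlyIndependent (λ i → p (s i))
linIndep-sub p s s-inj p-indep a combination i =
  trans (sym (extend-image s s-inj a i)) (p-indep (extend s a) extended (s i))
  where
  extended : ∀ e → ∑ (λ j → extend s a j * p j e) ≡ 0ℚ
  extended e = begin
    ∑ (λ j → extend s a j * p j e)         ≡⟨ sym (∑-reindex s s-inj _ support) ⟩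
    ∑ (λ i → extend s a (s i) * p (s i) e) ≡⟨ ∑-cong (λ i → cong (_* p (s i) e) (extend-image s s-inj a i)) ⟩
    ∑ (λ i → a i * p (s i) e)              ≡⟨ combination e ⟩
    0ℚ                                     ∎
    where
    open ≡-Reasoning
    support : ∀ j → (∃ λ i → s i ≡ j) ⊎ extend s a j * p j e ≡ 0ℚ
    support j with extend-support s a j
    ... | inj₁ image = inj₁ image
    ... | inj₂ a↑j≡0 = inj₂ (trans (cong (_* p j e) a↑j≡0) (*-zeroˡ (p j e)))

linIndep-restrict : ∀ {k l l′} (p : Fin k → Fin l → ℚ) (ι : Fin l′ → Fin l) (q : Fin k → Fin l′ → ℚ) →
  (∀ i e → q i e ≡ p i (ι e)) → (∀ f → (∃ λ e → ι e ≡ f) ⊎ (∀ i → p i f ≡ 0ℚ)) →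
  LinearlyIndependent p → LinearlyIndependent q
linIndep-restrict p ι q q-restricts covers p-indep a combination = p-indep a combinationᵖ
  where
  combinationᵖ : ∀ f → ∑ (λ i → a i * p i f) ≡ 0ℚ
  combinationᵖ f with covers f
  ... | inj₁ (e , refl) = trans (∑-cong (λ i → cong (a i *_) (sym (q-restricts i e)))) (combination e)
  ... | inj₂ vanish     = ∑-zero (λ i → trans (cong (a i *_) (vanish i)) (*-zeroʳ (a i)))

0≤1 : 0ℚ ≤ 1ℚ
0≤1 = <⇒≤ (positive⁻¹ 1ℚ)

cut∈CUT : (K : Graph) (T : Subset (n K)) → Proper T → CUT K (χδ K T)
cut∈CUT K T T-proper =
  1 , (λ _ → T) , (λ _ → 1ℚ) , (λ _ → T-proper) , (λ _ → 0≤1) , +-identityʳ 1ℚ ,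
  λ e → ≤-reflexive (trans (+-identityʳ _) (*-identityˡ _))

CUT-upward : (K : Graph) {x y : Fin (m K) → ℚ} → CUT K x → (∀ e → x e ≤ y e) → CUT K y
CUT-upward K (k , S , μ , proper , μ≥0 , ∑μ≡1 , below) x≤y =
  k , S , μ , proper , μ≥0 , ∑μ≡1 , λ e → ≤-trans (below e) (x≤y e)

-- For nonnegative weights, a lower bound on all cut weights is valid on CUT(K):
-- a point of CUT(K) dominates a convex combination of cut vectors.
cuts⇒valid : (K : Graph) (w : Fin (m K) → ℚ) → (∀ e → 0ℚ ≤ w e) → (L : ℚ) →
  (∀ T → Proper T → L ≤ cutWeight K w T) → Valid (CUT K) w L
cuts⇒valid K w w≥0 L bound x (k , S , μ , proper , μ≥0 , ∑μ≡1 , below) = begin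
  L                                             ≡⟨ sym L-as-combination ⟩
  ∑ (λ i → μ i * L)                             ≤⟨ ∑-mono (λ i → *-monoˡ-≤-nonNeg (μ i) {{nonNegative (μ≥0 i)}} (bound (S i) (proper i))) ⟩
  ∑ (λ i → μ i * cutWeight K w (S i))           ≡⟨ exchange ⟩
  ∑ (λ e → w e * ∑ (λ i → μ i * χδ K (S i) e)) ≤⟨ ∑-mono (λ e → *-monoˡ-≤-nonNeg (w e) {{nonNegative (w≥0 e)}} (below e)) ⟩
  ⟨ w , x ⟩                                     ∎
  where
  open ≤-Reasoning
  L-as-combination : ∑ (λ i → μ i * L) ≡ L
  L-as-combination = begin-equality
    ∑ (λ i → μ i * L) ≡⟨ ∑-cong (λ i → *-comm (μ i) L) ⟩
    ∑ (λ i → L * μ i) ≡⟨ ∑-*ˡ L μ ⟩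
    L * ∑ μ           ≡⟨ cong (L *_) ∑μ≡1 ⟩
    L * 1ℚ            ≡⟨ *-identityʳ L ⟩
    L                 ∎
  rearrange : ∀ a b c → a * (b * c) ≡ b * (a * c)
  rearrange a b c = trans (sym (*-assoc a b c)) (trans (cong (_* c) (*-comm a b)) (*-assoc b a c))
  exchange : ∑ (λ i → μ i * cutWeight K w (S i)) ≡ ∑ (λ e → w e * ∑ (λ i → μ i * χδ K (S i) e))
  exchange = begin-equality
    ∑ (λ i → μ i * ∑ (λ e → w e * χδ K (S i) e))   ≡⟨ ∑-cong (λ i → sym (∑-*ˡ (μ i) (λ e → w e * χδ K (S i) e))) ⟩
    ∑ (λ i → ∑ (λ e → μ i * (w e * χδ K (S i) e))) ≡⟨ ∑-swap (λ i e → μ i * (w e * χδ K (S i) e)) ⟩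
    ∑ (λ e → ∑ (λ i → μ i * (w e * χδ K (S i) e))) ≡⟨ ∑-cong (λ e → ∑-cong (λ i → rearrange (μ i) (w e) _)) ⟩
    ∑ (λ e → ∑ (λ i → w e * (μ i * χδ K (S i) e))) ≡⟨ ∑-cong (λ e → ∑-*ˡ (w e) (λ i → μ i * χδ K (S i) e)) ⟩
    ∑ (λ e → w e * ∑ (λ i → μ i * χδ K (S i) e))   ∎

unit : ∀ {k} → Fin k → Fin k → ℚ
unit i j = onlyAt i j 1ℚ

unit-nonneg : ∀ {k} (i j : Fin k) → 0ℚ ≤ unit i j
unit-nonneg i j with does (i ≟ j)
... | true  = 0≤1
... | false = ≤-refl

⟨⟩-unit : ∀ {k} (c : Fin k → ℚ) (i : Fin k) → ⟨ c , unit i ⟩ ≡ c i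
⟨⟩-unit c i = begin
  ∑ (λ j → c j * onlyAt i j 1ℚ) ≡⟨ ∑-cong (λ j → *-onlyAt i j (c j) 1ℚ) ⟩
  ∑ (λ j → onlyAt i j (c j * 1ℚ)) ≡⟨ ∑-onlyAt i (λ j → c j * 1ℚ) ⟩
  c i * 1ℚ                        ≡⟨ *-identityʳ (c i) ⟩
  c i                             ∎
  where open ≡-Reasoning

-- An inequality valid for CUT(K) and tight at some point of CUT(K) has nonnegative
-- coefficients: otherwise moving that point up along a unit vector would violate it.
tight⇒nonneg : (K : Graph) (c : Fin (m K) → ℚ) (λ₀ : ℚ) → Valid (CUT K) c λ₀ →
  (p : Fin (m K) → ℚ) → CUT K p → ⟨ c , p ⟩ ≡ λ₀ → ∀ e → 0ℚ ≤ c e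
tight⇒nonneg K c λ₀ valid p p∈CUT tight e = ≮⇒≥ λ ce<0 → <-irrefl refl (begin-strict
  λ₀              ≤⟨ valid (λ f → p f + unit e f) moved∈CUT ⟩
  ⟨ c , (λ f → p f + unit e f) ⟩ ≡⟨ value ⟩
  λ₀ + c e        <⟨ +-monoʳ-< λ₀ ce<0 ⟩
  λ₀ + 0ℚ         ≡⟨ +-identityʳ λ₀ ⟩
  λ₀              ∎)
  where
  open ≤-Reasoning
  moved∈CUT : CUT K (λ f → p f + unit e f)
  moved∈CUT = CUT-upward K p∈CUT λ f →
    ≤-trans (≤-reflexive (sym (+-identityʳ (p f)))) (+-monoʳ-≤ (p f) (unit-nonneg e f))
  value : ⟨ c , (λ f → p f + unit e f) ⟩ ≡ λ₀ + c e
  value = begin-equality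
    ∑ (λ f → c f * (p f + unit e f))      ≡⟨ ∑-cong (λ f → *-distribˡ-+ (c f) (p f) (unit e f)) ⟩
    ∑ (λ f → c f * p f + c f * unit e f) ≡⟨ ∑-+ (λ f → c f * p f) (λ f → c f * unit e f) ⟩
    ⟨ c , p ⟩ + ⟨ c , unit e ⟩            ≡⟨ cong₂ _+_ tight (⟨⟩-unit c e) ⟩
    λ₀ + c e                               ∎

minCut-weight : (K : Graph) (c : Fin (m K) → ℚ) (λ₀ : ℚ) → Valid (CUT K) c λ₀ →
  (p : Fin (m K) → ℚ) → CUT K p → ⟨ c , p ⟩ ≡ λ₀ →
  ∀ S → IsMinCut K c S → cutWeight K c S ≡ λ₀
minCut-weight K c λ₀ valid p p∈CUT tight S (S-proper , S-minimal) = ≤-antisym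
  (≤-trans (cuts⇒valid K c (tight⇒nonneg K c λ₀ valid p p∈CUT tight) _ S-minimal p p∈CUT) (≤-reflexive tight))
  (valid (χδ K S) (cut∈CUT K S S-proper))

record Avoids (G : Graph) (S : Subset (n G)) (E′ : Subset (m G)) : Set where
  constructor avoiding
  field misses : ∀ f → f ∈ E′ → inCut G S f ≡ false
open Avoids

avoids-χ : (G : Graph) {S : Subset (n G)} {E′ : Subset (m G)} → Avoids G S E′ →
  ∀ {f} → f ∈ E′ → χδ G S f ≡ 0ℚ
avoids-χ G avoids f∈E′ rewrite misses avoids _ f∈E′ = refl

noneB-lookup : ∀ {k} (v : Subset k) → noneB v ≡ true → ∀ i → lookup v i ≡ false
noneB-lookup (true  ∷ v) ()
noneB-lookup (false ∷ v) none zero    = refl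
noneB-lookup (false ∷ v) none (suc i) = noneB-lookup v none i

noneB⇒avoids : (G : Graph) (S : Subset (n G)) (E′ : Subset (m G)) →
  noneB (δ G S ∩ E′) ≡ true → Avoids G S E′
noneB⇒avoids G S E′ none = avoiding λ f f∈E′ → begin
  inCut G S f                       ≡⟨ sym (∧-identityʳ (inCut G S f)) ⟩
  inCut G S f ∧ true                ≡⟨ cong₂ _∧_ (sym (lookup∘tabulate (inCut G S) f)) (sym ([]=⇒lookup f∈E′)) ⟩
  lookup (δ G S) f ∧ lookup E′ f    ≡⟨ sym (lookup-zipWith _∧_ f (δ G S) E′) ⟩
  lookup (δ G S ∩ E′) f             ≡⟨ noneB-lookup (δ G S ∩ E′) none f ⟩
  false                             ∎
  where open ≡-Reasoning

enumerate : ∀ {k} (P : Subset k) → Fin ∣ P ∣ → Fin k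
enumerate (inside  ∷ P) zero    = zero
enumerate (inside  ∷ P) (suc i) = suc (enumerate P i)
enumerate (outside ∷ P) i       = suc (enumerate P i)

enumerate-injective : ∀ {k} (P : Subset k) → Injective _≡_ _≡_ (enumerate P)
enumerate-injective (inside  ∷ P) {zero}  {zero}  _  = refl
enumerate-injective (inside  ∷ P) {suc i} {suc j} eq = cong suc (enumerate-injective P (suc-injective eq))
enumerate-injective (outside ∷ P)                 eq = enumerate-injective P (suc-injective eq)

enumerate-∈ : ∀ {k} (P : Subset k) → ∀ i → enumerate P i ∈ P
enumerate-∈ (inside  ∷ P) zero    = here
enumerate-∈ (inside  ∷ P) (suc i) = there (enumerate-∈ P i)
enumerate-∈ (outside ∷ P) i       = there (enumerate-∈ P i)

avoidingMembers : (G : Graph) (E′ : Subset (m G)) {k : ℕ.ℕ} (𝓕 : Fin k → Subset (n G)) →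
  Σ (Fin ∣ tabulate (λ i → noneB (δ G (𝓕 i) ∩ E′)) ∣ → Fin k) λ s →
    Injective _≡_ _≡_ s × (∀ i → Avoids G (𝓕 (s i)) E′)
avoidingMembers G E′ {k} 𝓕 = enumerate P , enumerate-injective P , avoids
  where
  P : Subset k
  P = tabulate (λ i → noneB (δ G (𝓕 i) ∩ E′))
  avoids : ∀ i → Avoids G (𝓕 (enumerate P i)) E′
  avoids i = noneB⇒avoids G (𝓕 (enumerate P i)) E′
    (trans (sym (lookup∘tabulate _ (enumerate P i))) ([]=⇒lookup (enumerate-∈ P i)))

xor≡false⇒≡ : ∀ a b → a xor b ≡ false → a ≡ b
xor≡false⇒≡ true  true  _ = refl
xor≡false⇒≡ false false _ = refl

module Contraction {G : Graph} {E′ : Subset (m G)} {H : Graph}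
                   {π : Fin (n G) → Fin (n H)} {ι : Fin (m H) → Fin (m G)}
                   (contraction : IsContraction G E′ H π ι) where
  open IsContraction contraction

  record Lifts (T : Subset (n H)) (S : Subset (n G)) : Set where
    constructor lifting
    field membership : ∀ v → lookup T (π v) ≡ lookup S v
  open Lifts

  lifts-∁ : ∀ {T S} → Lifts T S → Lifts (∁ T) (∁ S)
  lifts-∁ {T} {S} lifts = lifting λ v → begin
    lookup (∁ T) (π v) ≡⟨ lookup-map (π v) not T ⟩
    not (lookup T (π v)) ≡⟨ cong not (membership lifts v) ⟩
    not (lookup S v)     ≡⟨ sym (lookup-map v not S) ⟩
    lookup (∁ S) v       ∎
    where open ≡-Reasoning

  lifts-nonempty→ : ∀ {T S} → Lifts T S → Nonempty S → Nonempty T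
  lifts-nonempty→ {T} lifts (v , v∈S) = π v , lookup⇒[]= (π v) T (trans (membership lifts v) ([]=⇒lookup v∈S))

  lifts-nonempty← : ∀ {T S} → Lifts T S → Nonempty T → Nonempty S
  lifts-nonempty← {T} {S} lifts (w , w∈T) with π-surj w
  ... | v , refl = v , lookup⇒[]= v S (trans (sym (membership lifts v)) ([]=⇒lookup w∈T))

  lifts-proper→ : ∀ {T S} → Lifts T S → Proper S → Proper T
  lifts-proper→ lifts (S≠∅ , ∁S≠∅) = lifts-nonempty→ lifts S≠∅ , lifts-nonempty→ (lifts-∁ lifts) ∁S≠∅

  lifts-proper← : ∀ {T S} → Lifts T S → Proper T → Proper S
  lifts-proper← lifts (T≠∅ , ∁T≠∅) = lifts-nonempty← lifts T≠∅ , lifts-nonempty← (lifts-∁ lifts) ∁T≠∅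

  lift : Subset (n H) → Subset (n G)
  lift T = tabulate (λ v → lookup T (π v))

  lift-lifts : ∀ T → Lifts T (lift T)
  lift-lifts T = lifting λ v → sym (lookup∘tabulate (λ v → lookup T (π v)) v)

  -- Contracted edges become loops, so preimages avoid them.
  lifts⇒avoids : ∀ {T S} → Lifts T S → Avoids G S E′
  lifts⇒avoids {T} {S} lifts = avoiding loop
    where
    open ≡-Reasoning
    loop : ∀ f → f ∈ E′ → inCut G S f ≡ false
    loop f f∈E′ = begin
      lookup S u xor lookup S w ≡⟨ cong (_xor lookup S w) same-side ⟩
      lookup S w xor lookup S w ≡⟨ xor-same (lookup S w) ⟩
      false                     ∎
      where
      u w : Fin (n G)
      u = proj₁ (ends G f)
      w = proj₂ (ends G f)
      same-side : lookup S u ≡ lookup S w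
      same-side = begin
        lookup S u     ≡⟨ sym (membership lifts u) ⟩
        lookup T (π u) ≡⟨ cong (lookup T) (Equivalence.from (π-conn u w) (stepˡ f f∈E′ refl here)) ⟩
        lookup T (π w) ≡⟨ membership lifts w ⟩
        lookup S w     ∎

  -- Conversely a set whose cut avoids E' is constant on the components of (V, E'),
  -- hence a preimage.
  avoids-constant : ∀ {S} → Avoids G S E′ → ∀ {u v} → Conn G E′ u v → lookup S u ≡ lookup S v
  avoids-constant avoids here = refl
  avoids-constant {S} avoids (stepˡ e e∈E′ ends≡ rest) =
    trans (xor≡false⇒≡ _ _ (subst (λ uw → lookup S (proj₁ uw) xor lookup S (proj₂ uw) ≡ false) ends≡ (misses avoids e e∈E′)))
          (avoids-constant avoids rest)
  avoids-constant {S} avoids (stepʳ e e∈E′ ends≡ rest) =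
    trans (sym (xor≡false⇒≡ _ _ (subst (λ wu → lookup S (proj₁ wu) xor lookup S (proj₂ wu) ≡ false) ends≡ (misses avoids e e∈E′))))
          (avoids-constant avoids rest)

  avoids⇒lifts : ∀ {S} → Avoids G S E′ → ∃[ T ] Lifts T S
  avoids⇒lifts {S} avoids = T , T-lifts
    where
    T : Subset (n H)
    T = tabulate (λ w → lookup S (proj₁ (π-surj w)))
    T-lifts : Lifts T S
    T-lifts = lifting λ v → trans (lookup∘tabulate (λ w → lookup S (proj₁ (π-surj w))) (π v))
                      (avoids-constant avoids (Equivalence.to (π-conn _ v) (proj₂ (π-surj (π v)))))

  lifts-χ : ∀ {T S} → Lifts T S → ∀ e → χδ H T e ≡ χδ G S (ι e)
  lifts-χ lifts e rewrite ι-ends e | membership lifts (proj₁ (ends G (ι e))) | membership lifts (proj₂ (ends G (ι e))) = refl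

  contracted-or-kept : ∀ f → f ∈ E′ ⊎ ∃[ e ] ι e ≡ f
  contracted-or-kept f with f ∈? E′
  ... | yes f∈E′ = inj₁ f∈E′
  ... | no  f∉E′ = inj₂ (ι-onto f f∉E′)

  ∑-contract : (g : Fin (m G) → ℚ) → (∀ {f} → f ∈ E′ → g f ≡ 0ℚ) → ∑ (λ e → g (ι e)) ≡ ∑ g
  ∑-contract g vanish = ∑-reindex ι ι-inj g covers
    where
    covers : ∀ f → (∃ λ e → ι e ≡ f) ⊎ g f ≡ 0ℚ
    covers f with contracted-or-kept f
    ... | inj₁ f∈E′ = inj₂ (vanish f∈E′)
    ... | inj₂ kept = inj₁ kept

  lifts-weight : (c : Fin (m G) → ℚ) → ∀ {T S} → Lifts T S →
    cutWeight H (λ e → c (ι e)) T ≡ cutWeight G c S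
  lifts-weight c {T} {S} lifts = begin
    ∑ (λ e → c (ι e) * χδ H T e)     ≡⟨ ∑-cong (λ e → cong (c (ι e) *_) (lifts-χ lifts e)) ⟩
    ∑ (λ e → c (ι e) * χδ G S (ι e)) ≡⟨ ∑-contract (λ f → c f * χδ G S f) vanish ⟩
    ∑ (λ f → c f * χδ G S f)         ∎
    where
    open ≡-Reasoning
    vanish : ∀ {f} → f ∈ E′ → c f * χδ G S f ≡ 0ℚ
    vanish {f} f∈E′ = trans (cong (c f *_) (avoids-χ G (lifts⇒avoids lifts) f∈E′)) (*-zeroʳ (c f))

  -- Cut vectors of preimages, restricted along ι, keep their linear independence,
  -- since they vanish on the contracted edges.
  restricted-independent : ∀ {k} (S : Fin k → Subset (n G)) (T : Fin k → Subset (n H)) →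
    (∀ i → Lifts (T i) (S i)) → LinearlyIndependent (λ i → χδ G (S i)) →
    LinearlyIndependent (λ i → χδ H (T i))
  restricted-independent S T lifts =
    linIndep-restrict (λ i → χδ G (S i)) ι (λ i → χδ H (T i)) (λ i → lifts-χ (lifts i)) kept-or-vanishing
    where
    kept-or-vanishing : ∀ f → (∃[ e ] ι e ≡ f) ⊎ (∀ i → χδ G (S i) f ≡ 0ℚ)
    kept-or-vanishing f with contracted-or-kept f
    ... | inj₁ f∈E′ = inj₂ (λ i → avoids-χ G (lifts⇒avoids (lifts i)) f∈E′)
    ... | inj₂ kept = inj₁ kept

  -- Validity passes to the contraction: every cut of H weighs as much as a cut of G.
  contraction-valid : (c : Fin (m G) → ℚ) (λ₀ : ℚ) → Valid (CUT G) c λ₀ → (∀ f → 0ℚ ≤ c f) →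
    Valid (CUT H) (λ e → c (ι e)) λ₀
  contraction-valid c λ₀ valid c≥0 = cuts⇒valid H (λ e → c (ι e)) (λ e → c≥0 (ι e)) λ₀ cut-bound
    where
    cut-bound : ∀ T → Proper T → λ₀ ≤ cutWeight H (λ e → c (ι e)) T
    cut-bound T T-proper = ≤-trans
      (valid (χδ G (lift T)) (cut∈CUT G (lift T) (lifts-proper← (lift-lifts T) T-proper)))
      (≤-reflexive (sym (lifts-weight c (lift-lifts T))))

  lifts-face : (c : Fin (m G) → ℚ) (λ₀ : ℚ) → ∀ {T S} → Lifts T S → Proper S →
    cutWeight G c S ≡ λ₀ → Face (CUT H) (λ e → c (ι e)) λ₀ (χδ H T)
  lifts-face c λ₀ {T} lifts S-proper weight≡λ₀ =
    cut∈CUT H T (lifts-proper→ lifts S-proper) , trans (lifts-weight c lifts) weight≡λ₀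

lemma2p5 : (G : Graph) → 2 ℕ.≤ n G →
    (c : Fin (m G) → ℚ) (λ₀ : ℚ) →
    FacetDefining (CUT G) c λ₀ → 0ℚ < λ₀ → (∀ e → ¬ (c e ≡ 0ℚ)) →
    (𝓕 : Fin (m G) → Subset (n G)) → BasisOfMinCuts G c 𝓕 →
    (E' : Subset (m G)) (H : Graph) (π : Fin (n G) → Fin (n H)) (ι : Fin (m H) → Fin (m G)) →
    IsContraction G E' H π ι → 2 ℕ.≤ n H →
    Valid (CUT H) (λ e → c (ι e)) λ₀ ×
    HasAffIndep (Face (CUT H) (λ e → c (ι e)) λ₀) (countAvoiding G E' 𝓕)
lemma2p5 G _ c λ₀ (valid , _ , _ , (points , _ , on-face) , _) _ _ 𝓕 (minCuts , 𝓕-indep)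
         E' H π ι contraction _ =
  contraction-valid c λ₀ valid c≥0 , (λ i → χδ H (T i)) , affIndep , onFace
  where
  open Contraction contraction
  -- any point of the (nonempty) face makes the inequality tight
  c≥0 : ∀ f → 0ℚ ≤ c f
  c≥0 = tight⇒nonneg G c λ₀ valid (points zero) (proj₁ (on-face zero)) (proj₂ (on-face zero))
  s : Fin (countAvoiding G E' 𝓕) → Fin (m G)
  s = proj₁ (avoidingMembers G E' 𝓕)
  lifted : ∀ i → ∃[ T ] Lifts T (𝓕 (s i))
  lifted i = avoids⇒lifts (proj₂ (proj₂ (avoidingMembers G E' 𝓕)) i)
  T : Fin (countAvoiding G E' 𝓕) → Subset (n H)
  T i = proj₁ (lifted i)
  onFace : ∀ i → Face (CUT H) (λ e → c (ι e)) λ₀ (χδ H (T i))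
  onFace i = lifts-face c λ₀ (proj₂ (lifted i)) (proj₁ (minCuts (s i)))
    (minCut-weight G c λ₀ valid (points zero) (proj₁ (on-face zero)) (proj₂ (on-face zero)) (𝓕 (s i)) (minCuts (s i)))
  affIndep : AffinelyIndependent (λ i → χδ H (T i))
  affIndep a _ = restricted-independent (λ i → 𝓕 (s i)) T (λ i → proj₂ (lifted i))
    (linIndep-sub (λ j → χδ G (𝓕 j)) s (proj₁ (proj₂ (avoidingMembers G E' 𝓕))) 𝓕-indep) a
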